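{- Let $g(p)$ denote the length of the shortest squarefree word over a ternary alphabet having exactly $p$ nontrivial periods. Then for every $p\ge3$, $g(p) \leq \frac{17}{12}4^{p-1} + \frac13$.
   Context: A square is a nonempty word of the form $xx$; a word is squarefree if none of its factors is a square. For a finite nonempty word $w$, an integer $p$ with $1\le p\le|w|$ is a period if $w[i]=w[i+p]$ for $1\le i\le |w|-p$; it is nontrivial if $p<|w|$. -}

module Defs where

open import Data.Nat using (ℕ; zero; suc; _+_; _*_; _^_; _≤_; _<_)
open import Data.Fin using (Fin)
open import Data.List using (List; []; _∷_; _++_; length)
open import Data.List.Membership.Propositional using (_∈_)
open import Data.List.Relation.Unary.Unique.Propositional using (Unique)
open import Data.Maybe using (Maybe; just; nothing)
open import Data.Product using (Σ; _×_; ∃)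
open import Relation.Binary.PropositionalEquality using (_≡_; _≢_)
open import Relation.Nullary using (¬_)

Word : Set
Word = List (Fin 3)

at : {A : Set} → List A → ℕ → Maybe A
at []       _       = nothing
at (x ∷ xs) zero    = just x
at (x ∷ xs) (suc i) = at xs i

Squarefree : {A : Set} → List A → Set
Squarefree {A} w = ¬ (Σ (List A) λ u → Σ (List A) λ x → Σ (List A) λ v →
                      (x ≢ []) × (w ≡ u ++ x ++ x ++ v))

IsPeriod : {A : Set} → List A → ℕ → Set
IsPeriod w p = (1 ≤ p) × (p ≤ length w) ×
               (∀ i → i + p < length w → at w i ≡ at w (i + p))

IsNontrivialPeriod : {A : Set} → List A → ℕ → Set
IsNontrivialPeriod w p = IsPeriod w p × (p < length w)

HasExactlyNontrivialPeriods : {A : Set} → List A → ℕ → Set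
HasExactlyNontrivialPeriods w k =
  Σ (List ℕ) λ qs → Unique qs × (∀ q → (q ∈ qs → IsNontrivialPeriod w q) × (IsNontrivialPeriod w q → q ∈ qs))
                  × (length qs ≡ k)

module Submission where

-- Let h be the 13-uniform morphism defined below and H its extension to words.  If
-- w = 𝟎 … 𝟎 is squarefree with |w| ≥ 5 and exactly p nontrivial periods, then H w is again
-- squarefree, begins and ends with 𝟎, has length 13·|w|, and its nontrivial periods are
-- exactly the 13k (k a nontrivial period of w) and 13(|w|-1) + e (e a nontrivial period of
-- h 𝟎, i.e. e = 8, 12).  So p ↦ p + 2 while |w| ↦ 13|w|, which preserves the bound
-- 12|w| ≤ 17·4^(p-1) + 4.  Explicit seeds for p = 3, 4 start the induction.

open import Defs
open import Data.Bool using (Bool; true; false; T; not; _∧_; _∨_)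
open import Data.Bool.ListAction using (all)
open import Data.Bool.Properties using (T-∧; T-≡)
open import Data.Empty using (⊥-elim)
open import Data.Fin using (Fin; zero; suc)
import Data.Fin as Fin
open import Data.List using (List; []; _∷_; _++_; length; drop; take; map; upTo; filter; allFin)
open import Data.List.Properties using (length-++; length-map; ++-assoc; drop-[]; take-[]; length-take; length-drop)
open import Data.List.Membership.Propositional using (_∈_)
open import Data.List.Membership.Propositional.Properties
  using (∈-filter⁺; ∈-filter⁻; ∈-upTo⁺; ∈-allFin; ∈-++⁺ˡ; ∈-++⁺ʳ; ∈-++⁻; ∈-map⁺; ∈-map⁻)
open import Data.List.Relation.Unary.All using (lookup)
open import Data.List.Relation.Unary.All.Properties using (all⁺)
open import Data.List.Relation.Unary.Unique.Propositional using (Unique)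
import Data.List.Relation.Unary.Unique.Propositional.Properties as Unique
open import Data.Maybe using (just; nothing; _>>=_)
open import Data.Nat using (ℕ; zero; suc; _+_; _*_; _∸_; _^_; _≤_; _<_; z≤n; s≤s; _≤ᵇ_; _≤?_; _<?_; _/_; _%_)
open import Data.Nat.DivMod using (m≡m%n+[m/n]*n; m%n<n; m/n*n≤m; [m+kn]%n≡m%n; m*n%n≡0; m<n⇒m%n≡m)
open import Data.Nat.Properties
open import Data.Nat.Solver using (module +-*-Solver)
open import Data.Product using (Σ; _×_; _,_; proj₁; proj₂)
open import Data.Sum using (_⊎_; inj₁; inj₂)
open import Function using (Equivalence)
open import Relation.Binary.Definitions using (DecidableEquality)
open import Relation.Binary.PropositionalEquality
open import Relation.Nullary using (¬_; Dec; isYes; yes; no)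
open import Relation.Nullary.Decidable using (toWitness; fromWitness; T?; map′; _×-dec_)
open +-*-Solver using (solve; _:+_; _:*_; _:=_; con)

module _ {A : Set} where

  at-++ˡ : (xs ys : List A) (i : ℕ) → i < length xs → at (xs ++ ys) i ≡ at xs i
  at-++ˡ (x ∷ xs) ys zero    _         = refl
  at-++ˡ (x ∷ xs) ys (suc i) (s≤s i<n) = at-++ˡ xs ys i i<n

  at-++ʳ : (xs ys : List A) (i : ℕ) → at (xs ++ ys) (length xs + i) ≡ at ys i
  at-++ʳ []       ys i = refl
  at-++ʳ (x ∷ xs) ys i = at-++ʳ xs ys i

  at-drop : (k : ℕ) (xs : List A) (i : ℕ) → at (drop k xs) i ≡ at xs (k + i)
  at-drop zero    xs       i = refl
  at-drop (suc k) []       i = refl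
  at-drop (suc k) (x ∷ xs) i = at-drop k xs i

  at-take : (n : ℕ) (xs : List A) (i : ℕ) → i < n → at (take n xs) i ≡ at xs i
  at-take (suc n) []       i       _         = refl
  at-take (suc n) (x ∷ xs) zero    _         = refl
  at-take (suc n) (x ∷ xs) (suc i) (s≤s i<n) = at-take n xs i i<n

  at-just : (xs : List A) (i : ℕ) → i < length xs → Σ A λ x → at xs i ≡ just x
  at-just (x ∷ xs) zero    _         = x , refl
  at-just (x ∷ xs) (suc i) (s≤s i<n) = at-just xs i i<n

  at≡just⇒< : (xs : List A) (i : ℕ) {x : A} → at xs i ≡ just x → i < length xs
  at≡just⇒< []       i       ()
  at≡just⇒< (y ∷ xs) zero    _ = s≤s z≤n
  at≡just⇒< (y ∷ xs) (suc i) e = s≤s (at≡just⇒< xs i e)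

  drop-at : (xs : List A) (k : ℕ) (x : A) → at xs k ≡ just x → drop k xs ≡ x ∷ drop (suc k) xs
  drop-at (y ∷ xs) zero    x refl = refl
  drop-at (y ∷ xs) (suc k) x e    = drop-at xs k x e

  drop-++ʳ : (xs ys : List A) (k : ℕ) → drop (length xs + k) (xs ++ ys) ≡ drop k ys
  drop-++ʳ []       ys k = refl
  drop-++ʳ (x ∷ xs) ys k = drop-++ʳ xs ys k

  take-++ʳ : (xs ys : List A) (k : ℕ) → take (length xs + k) (xs ++ ys) ≡ xs ++ take k ys
  take-++ʳ []       ys k = refl
  take-++ʳ (x ∷ xs) ys k = cong (x ∷_) (take-++ʳ xs ys k)

SqAt : {A : Set} → List A → ℕ → ℕ → Set
SqAt w i l = (1 ≤ l) × (i + l + l ≤ length w) ×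
             (∀ j → j < l → at w (i + j) ≡ at w (i + l + j))

SqFree : {A : Set} → List A → Set
SqFree w = ∀ i l → ¬ SqAt w i l

Occurs : {A : Set} → List A → List A → ℕ → Set
Occurs v w a = (a + length v ≤ length w) × (∀ q → q < length v → at v q ≡ at w (a + q))

module _ {A : Set} where

  sqAt-half≤length : (w : List A) (i l : ℕ) → SqAt w i l → l ≤ length w
  sqAt-half≤length w i l (_ , fits , _) = ≤-trans (m≤n+m l (i + l)) fits

  sqFree⇒squarefree : (w : List A) → SqFree w → Squarefree w
  sqFree⇒squarefree w sf (u , []    , v , x≢[] , _)    = x≢[] refl
  sqFree⇒squarefree w sf (u , x@(_ ∷ _) , v , _ , refl) = sf (length u) (length x) (s≤s z≤n , fits , repeat)
    where
    lu = length u
    lx = length x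
    fits : lu + lx + lx ≤ length (u ++ x ++ x ++ v)
    fits = begin
      lu + lx + lx                     ≡⟨ +-assoc lu lx lx ⟩
      lu + (lx + lx)                   ≤⟨ +-monoʳ-≤ lu (+-monoʳ-≤ lx (m≤m+n lx (length v))) ⟩
      lu + (lx + (lx + length v))      ≡⟨ cong (λ n → lu + (lx + n)) (sym (length-++ x)) ⟩
      lu + (lx + length (x ++ v))      ≡⟨ cong (lu +_) (sym (length-++ x)) ⟩
      lu + length (x ++ x ++ v)        ≡⟨ sym (length-++ u) ⟩
      length (u ++ x ++ x ++ v)        ∎
      where open ≤-Reasoning
    repeat : ∀ j → j < lx → at (u ++ x ++ x ++ v) (lu + j) ≡ at (u ++ x ++ x ++ v) (lu + lx + j)
    repeat j j<lx = begin
      at (u ++ x ++ x ++ v) (lu + j)        ≡⟨ at-++ʳ u _ j ⟩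
      at (x ++ x ++ v) j                    ≡⟨ at-++ˡ x _ j j<lx ⟩
      at x j                                ≡⟨ sym (at-++ˡ x v j j<lx) ⟩
      at (x ++ v) j                         ≡⟨ sym (at-++ʳ x _ j) ⟩
      at (x ++ x ++ v) (lx + j)             ≡⟨ sym (at-++ʳ u _ (lx + j)) ⟩
      at (u ++ x ++ x ++ v) (lu + (lx + j)) ≡⟨ cong (at (u ++ x ++ x ++ v)) (sym (+-assoc lu lx j)) ⟩
      at (u ++ x ++ x ++ v) (lu + lx + j)   ∎
      where open ≡-Reasoning

  adjacent-distinct : (w : List A) → SqFree w → ∀ j {x y} →
                      at w j ≡ just x → at w (suc j) ≡ just y → x ≢ y
  adjacent-distinct w sf j {x} ex ey refl = sf j 1 (s≤s z≤n , fits , repeat)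
    where
    fits : j + 1 + 1 ≤ length w
    fits = subst (_≤ length w) (sym (trans (+-assoc j 1 1) (+-comm j 2))) (at≡just⇒< w (suc j) ey)
    repeat : ∀ t → t < 1 → at w (j + t) ≡ at w (j + 1 + t)
    repeat zero    _              = begin
      at w (j + 0)     ≡⟨ cong (at w) (+-identityʳ j) ⟩
      at w j           ≡⟨ trans ex (sym ey) ⟩
      at w (suc j)     ≡⟨ cong (at w) (sym (trans (+-identityʳ (j + 1)) (+-comm j 1))) ⟩
      at w (j + 1 + 0) ∎
      where open ≡-Reasoning
    repeat (suc t) (s≤s ())

  length-factor : (w : List A) (a n : ℕ) → a + n ≤ length w → length (take n (drop a w)) ≡ n
  length-factor w a n a+n≤ = trans (length-take n (drop a w))
    (m≤n⇒m⊓n≡m (subst (n ≤_) (sym (length-drop a w)) (m+n≤o⇒m≤o∸n n (subst (_≤ length w) (+-comm a n) a+n≤))))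

  factor-occurs : (w : List A) (a n : ℕ) → a + n ≤ length w → Occurs (take n (drop a w)) w a
  factor-occurs w a n a+n≤ = subst (λ m → a + m ≤ length w) (sym (length-factor w a n a+n≤)) a+n≤ , same
    where
    same : ∀ q → q < length (take n (drop a w)) → at (take n (drop a w)) q ≡ at w (a + q)
    same q q<len = trans (at-take n (drop a w) q (subst (q <_) (length-factor w a n a+n≤) q<len)) (at-drop a w q)

  sqAt-lift : {v w : List A} {a i l : ℕ} → Occurs v w a → SqAt v i l → SqAt w (a + i) l
  sqAt-lift {v} {w} {a} {i} {l} (fits , same) (l≥1 , len , repeat) = l≥1 , fits′ , repeat′
    where
    fits′ : a + i + l + l ≤ length w
    fits′ = begin
      a + i + l + l    ≡⟨ solve 3 (λ a i l → ((a :+ i) :+ l) :+ l := a :+ ((i :+ l) :+ l)) refl a i l ⟩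
      a + (i + l + l)  ≤⟨ +-monoʳ-≤ a len ⟩
      a + length v     ≤⟨ fits ⟩
      length w         ∎
      where open ≤-Reasoning
    repeat′ : ∀ j → j < l → at w (a + i + j) ≡ at w (a + i + l + j)
    repeat′ j j<l = begin
      at w (a + i + j)         ≡⟨ cong (at w) (+-assoc a i j) ⟩
      at w (a + (i + j))       ≡⟨ sym (same (i + j) (≤-<-trans (+-monoˡ-≤ j (m≤m+n i l)) second)) ⟩
      at v (i + j)             ≡⟨ repeat j j<l ⟩
      at v (i + l + j)         ≡⟨ same (i + l + j) second ⟩
      at w (a + (i + l + j))   ≡⟨ cong (at w) (solve 4 (λ a i l j → a :+ ((i :+ l) :+ j) := ((a :+ i) :+ l) :+ j) refl a i l j) ⟩
      at w (a + i + l + j)     ∎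
      where
      open ≡-Reasoning
      second : i + l + j < length v
      second = <-≤-trans (+-monoʳ-< (i + l) j<l) len

  sqFree-occurs : {v w : List A} {a : ℕ} → Occurs v w a → SqFree w → SqFree v
  sqFree-occurs {v} {w} {a} occ sf i l sq = sf (a + i) l (sqAt-lift {v} {w} {a} occ sq)

  sqAt-lower : {v w : List A} {a i l : ℕ} → Occurs v w a → a ≤ i → i + l + l ≤ a + length v →
               SqAt w i l → SqAt v (i ∸ a) l
  sqAt-lower {v} {w} {a} {i} {l} (_ , same) a≤i inside (l≥1 , _ , repeat) = l≥1 , fits′ , repeat′
    where
    i′ = i ∸ a
    shift : ∀ x → a + (i′ + x) ≡ i + x
    shift x = trans (sym (+-assoc a i′ x)) (cong (_+ x) (m+[n∸m]≡n a≤i))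
    shift₂ : ∀ x → a + (i′ + l + x) ≡ i + l + x
    shift₂ x = trans (cong (a +_) (+-assoc i′ l x)) (trans (shift (l + x)) (sym (+-assoc i l x)))
    fits′ : i′ + l + l ≤ length v
    fits′ = +-cancelˡ-≤ a _ _ (subst (_≤ a + length v) (sym (trans (cong (a +_) (+-assoc i′ l l))
              (trans (shift (l + l)) (sym (+-assoc i l l))))) inside)
    repeat′ : ∀ j → j < l → at v (i′ + j) ≡ at v (i′ + l + j)
    repeat′ j j<l = begin
      at v (i′ + j)             ≡⟨ same (i′ + j) (≤-<-trans (+-monoˡ-≤ j (m≤m+n i′ l)) second) ⟩
      at w (a + (i′ + j))       ≡⟨ cong (at w) (shift j) ⟩
      at w (i + j)              ≡⟨ repeat j j<l ⟩
      at w (i + l + j)          ≡⟨ cong (at w) (sym (shift₂ j)) ⟩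
      at w (a + (i′ + l + j))   ≡⟨ sym (same (i′ + l + j) second) ⟩
      at v (i′ + l + j)         ∎
      where
      open ≡-Reasoning
      second : i′ + l + j < length v
      second = <-≤-trans (+-monoʳ-< (i′ + l) j<l) fits′

T-not⇒¬T : ∀ {b} → T (not b) → ¬ T b
T-not⇒¬T {false} _ ()

¬T⇒T-not : ∀ {b} → ¬ T b → T (not b)
¬T⇒T-not {false} _  = _
¬T⇒T-not {true}  ¬t = ¬t _

T-∨-right : ∀ {a b} → T (a ∨ b) → ¬ T a → T b
T-∨-right {true}  _  ¬a = ⊥-elim (¬a _)
T-∨-right {false} tb _  = tb

all-sound : {X : Set} (p : X → Bool) (xs : List X) → all p xs ≡ true → ∀ {x} → x ∈ xs → T (p x)
all-sound p xs ok = lookup (all⁺ p xs (Equivalence.from T-≡ ok))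

-- Boolean deciders for squarefreeness and periods over an alphabet with decidable
-- equality, with soundness and completeness; they let finite facts be checked by evaluation.
module Decide {A : Set} (_≟_ : DecidableEquality A) where

  agree : ℕ → List A → List A → Bool
  agree zero    _        _        = true
  agree (suc n) []       []       = true
  agree (suc n) (x ∷ xs) (y ∷ ys) = isYes (x ≟ y) ∧ agree n xs ys
  agree (suc n) _        _        = false

  agree-sound : ∀ n xs ys → T (agree n xs ys) → ∀ t → t < n → at xs t ≡ at ys t
  agree-sound (suc n) []       []       _  t       _         = refl
  agree-sound (suc n) []       (_ ∷ _)  () t       _
  agree-sound (suc n) (_ ∷ _)  []       () t       _
  agree-sound (suc n) (x ∷ xs) (y ∷ ys) ok zero    _         =
    cong just (toWitness {a? = x ≟ y} (proj₁ (Equivalence.to (T-∧ {isYes (x ≟ y)}) ok)))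
  agree-sound (suc n) (x ∷ xs) (y ∷ ys) ok (suc t) (s≤s t<n) =
    agree-sound n xs ys (proj₂ (Equivalence.to (T-∧ {isYes (x ≟ y)}) ok)) t t<n

  agree-complete : ∀ n xs ys → (∀ t → t < n → at xs t ≡ at ys t) → T (agree n xs ys)
  agree-complete zero    xs       ys       _    = _
  agree-complete (suc n) []       []       _    = _
  agree-complete (suc n) []       (y ∷ ys) same with same 0 (s≤s z≤n)
  ... | ()
  agree-complete (suc n) (x ∷ xs) []       same with same 0 (s≤s z≤n)
  ... | ()
  agree-complete (suc n) (x ∷ xs) (y ∷ ys) same with same 0 (s≤s z≤n)
  ... | refl = Equivalence.from T-∧ (fromWitness {a? = x ≟ x} refl , agree-complete n xs ys (λ t t<n → same (suc t) (s≤s t<n)))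

  prefixSquare : ℕ → List A → Bool
  prefixSquare l s = (l + l ≤ᵇ length s) ∧ agree l s (drop l s)

  prefixSquare-sound : ∀ l s → 1 ≤ l → T (prefixSquare l s) → SqAt s 0 l
  prefixSquare-sound l s l≥1 ok = l≥1 , ≤ᵇ⇒≤ (l + l) (length s) fits ,
    λ j j<l → trans (agree-sound l s (drop l s) same j j<l) (at-drop l s j)
    where
    fits = proj₁ (Equivalence.to (T-∧ {l + l ≤ᵇ length s}) ok)
    same = proj₂ (Equivalence.to (T-∧ {l + l ≤ᵇ length s}) ok)

  prefixSquare-complete : ∀ l s → SqAt s 0 l → T (prefixSquare l s)
  prefixSquare-complete l s (_ , fits , repeat) = Equivalence.from T-∧ (≤⇒≤ᵇ fits ,
    agree-complete l s (drop l s) (λ t t<l → trans (repeat t t<l) (sym (at-drop l s t))))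

  noPrefixSquare : ℕ → List A → Bool
  noPrefixSquare zero    s = true
  noPrefixSquare (suc k) s = not (prefixSquare (suc k) s) ∧ noPrefixSquare k s

  noPrefixSquare-sound : ∀ k s → T (noPrefixSquare k s) → ∀ l → l ≤ k → ¬ SqAt s 0 l
  noPrefixSquare-sound zero    s ok .0 z≤n (() , _)
  noPrefixSquare-sound (suc k) s ok l  l≤  sq with m≤n⇒m<n∨m≡n l≤
  ... | inj₂ refl      = T-not⇒¬T (proj₁ parts) (prefixSquare-complete l s sq)
    where parts = Equivalence.to (T-∧ {not (prefixSquare (suc k) s)}) ok
  ... | inj₁ (s≤s l≤k) = noPrefixSquare-sound k s (proj₂ parts) l l≤k sq
    where parts = Equivalence.to (T-∧ {not (prefixSquare (suc k) s)}) ok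

  noPrefixSquare-complete : ∀ k s → (∀ l → ¬ SqAt s 0 l) → T (noPrefixSquare k s)
  noPrefixSquare-complete zero    s none = _
  noPrefixSquare-complete (suc k) s none = Equivalence.from T-∧
    (¬T⇒T-not (λ sq → none (suc k) (prefixSquare-sound (suc k) s (s≤s z≤n) sq)) ,
     noPrefixSquare-complete k s none)

  -- s is squarefree iff no suffix of s starts with a square.
  squarefree? : List A → Bool
  squarefree? []           = true
  squarefree? s@(_ ∷ rest) = noPrefixSquare (length s) s ∧ squarefree? rest

  squarefree?-sound : ∀ s → T (squarefree? s) → SqFree s
  squarefree?-sound []       _  i       l sq@(l≥1 , _ , _) = <⇒≱ l≥1 (sqAt-half≤length [] i l sq)
  squarefree?-sound (x ∷ xs) ok zero    l sq =
    noPrefixSquare-sound _ _ (proj₁ (Equivalence.to (T-∧ {noPrefixSquare (length (x ∷ xs)) (x ∷ xs)}) ok))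
      l (sqAt-half≤length _ 0 l sq) sq
  squarefree?-sound (x ∷ xs) ok (suc i) l (l≥1 , s≤s fits , repeat) =
    squarefree?-sound xs (proj₂ (Equivalence.to (T-∧ {noPrefixSquare (length (x ∷ xs)) (x ∷ xs)}) ok))
      i l (l≥1 , fits , repeat)

  squarefree?-complete : ∀ s → SqFree s → T (squarefree? s)
  squarefree?-complete []       _  = _
  squarefree?-complete (x ∷ xs) sf = Equivalence.from T-∧ (noPrefixSquare-complete (length (x ∷ xs)) (x ∷ xs) (sf 0) ,
    squarefree?-complete xs (λ i l (l≥1 , fits , repeat) → sf (suc i) l (l≥1 , s≤s fits , repeat)))

  Periodic : List A → ℕ → Set
  Periodic w q = ∀ i → i + q < length w → at w i ≡ at w (i + q)

  periodic? : ∀ w q → Dec (Periodic w q)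
  periodic? w q = map′ sound complete (T? (agree (length w ∸ q) w (drop q w)))
    where
    sound : T (agree (length w ∸ q) w (drop q w)) → Periodic w q
    sound ok i i+q< = trans (agree-sound _ w (drop q w) ok i (m+n≤o⇒m≤o∸n (suc i) i+q<))
                            (trans (at-drop q w i) (cong (at w) (+-comm q i)))
    complete : Periodic w q → T (agree (length w ∸ q) w (drop q w))
    complete per = agree-complete _ w (drop q w) λ t t<n∸q →
      trans (per t (m≤o∸n⇒m+n≤o (suc t) (<⇒≤ (m∸n≢0⇒n<m (λ e → n≮0 (subst (t <_) e t<n∸q)))) t<n∸q))
            (trans (cong (at w) (+-comm t q)) (sym (at-drop q w t)))

  nontrivialPeriod? : ∀ w q → Dec (IsNontrivialPeriod w q)
  nontrivialPeriod? w q = ((1 ≤? q) ×-dec (q ≤? length w) ×-dec periodic? w q) ×-dec (q <? length w)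

  periodList : List A → List ℕ
  periodList w = filter (nontrivialPeriod? w) (upTo (length w))

  periodList-exact : ∀ w → HasExactlyNontrivialPeriods w (length (periodList w))
  periodList-exact w = periodList w , Unique.filter⁺ (nontrivialPeriod? w) (Unique.upTo⁺ (length w)) ,
    (λ q → (λ q∈ → proj₂ (∈-filter⁻ (nontrivialPeriod? w) {xs = upTo (length w)} q∈)) ,
           (λ per → ∈-filter⁺ (nontrivialPeriod? w) (∈-upTo⁺ (proj₂ per)) per)) ,
    refl

module UniformMorphism {A : Set} (f : A → List A) (k : ℕ) (length-f : ∀ a → length (f a) ≡ k) where

  image : List A → List A
  image []       = []
  image (x ∷ xs) = f x ++ image xs

  length-image : ∀ w → length (image w) ≡ length w * k
  length-image []       = refl
  length-image (x ∷ xs) = trans (length-++ (f x)) (cong₂ _+_ (length-f x) (length-image xs))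

  at-image : ∀ w j s → s < k → at (image w) (j * k + s) ≡ (at w j >>= λ a → at (f a) s)
  at-image []       j       s _   = refl
  at-image (x ∷ xs) zero    s s<k = at-++ˡ (f x) (image xs) s (subst (s <_) (sym (length-f x)) s<k)
  at-image (x ∷ xs) (suc j) s s<k = begin
    at (f x ++ image xs) (k + j * k + s)             ≡⟨ cong (at (f x ++ image xs)) (+-assoc k (j * k) s) ⟩
    at (f x ++ image xs) (k + (j * k + s))           ≡⟨ cong (λ n → at (f x ++ image xs) (n + (j * k + s))) (sym (length-f x)) ⟩
    at (f x ++ image xs) (length (f x) + (j * k + s)) ≡⟨ at-++ʳ (f x) (image xs) (j * k + s) ⟩
    at (image xs) (j * k + s)                        ≡⟨ at-image xs j s s<k ⟩
    (at xs j >>= λ a → at (f a) s)                   ∎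
    where open ≡-Reasoning

  at-image-letter : ∀ w j s {a} → at w j ≡ just a → s < k → at (image w) (j * k + s) ≡ at (f a) s
  at-image-letter w j s ea s<k = trans (at-image w j s s<k) (cong (_>>= λ a → at (f a) s) ea)

  image-drop : ∀ n w → image (drop n w) ≡ drop (n * k) (image w)
  image-drop zero    w        = refl
  image-drop (suc n) []       = sym (drop-[] (suc n * k))
  image-drop (suc n) (x ∷ xs) = begin
    image (drop n xs)                          ≡⟨ image-drop n xs ⟩
    drop (n * k) (image xs)                    ≡⟨ sym (drop-++ʳ (f x) (image xs) (n * k)) ⟩
    drop (length (f x) + n * k) (image (x ∷ xs)) ≡⟨ cong (λ m → drop (m + n * k) (image (x ∷ xs))) (length-f x) ⟩
    drop (k + n * k) (image (x ∷ xs))          ∎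
    where open ≡-Reasoning

  image-take : ∀ n w → image (take n w) ≡ take (n * k) (image w)
  image-take zero    w        = refl
  image-take (suc n) []       = sym (take-[] (suc n * k))
  image-take (suc n) (x ∷ xs) = begin
    f x ++ image (take n xs)                   ≡⟨ cong (f x ++_) (image-take n xs) ⟩
    f x ++ take (n * k) (image xs)             ≡⟨ sym (take-++ʳ (f x) (image xs) (n * k)) ⟩
    take (length (f x) + n * k) (image (x ∷ xs)) ≡⟨ cong (λ m → take (m + n * k) (image (x ∷ xs))) (length-f x) ⟩
    take (k + n * k) (image (x ∷ xs))          ∎
    where open ≡-Reasoning

  at-image-pair : ∀ w j {x y} s → at w j ≡ just x → at w (suc j) ≡ just y → s < k + k →
                  at (image w) (j * k + s) ≡ at (f x ++ f y) s
  at-image-pair w j {x} {y} s ex ey s<2k = begin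
    at (image w) (j * k + s)                         ≡⟨ sym (at-drop (j * k) (image w) s) ⟩
    at (drop (j * k) (image w)) s                    ≡⟨ cong (λ u → at u s) (sym (image-drop j w)) ⟩
    at (image (drop j w)) s                          ≡⟨ cong (λ u → at (image u) s) (drop-at w j x ex) ⟩
    at (f x ++ image (drop (suc j) w)) s             ≡⟨ cong (λ u → at (f x ++ image u) s) (drop-at w (suc j) y ey) ⟩
    at (f x ++ f y ++ image (drop (suc (suc j)) w)) s ≡⟨ cong (λ u → at u s) (sym (++-assoc (f x) (f y) _)) ⟩
    at ((f x ++ f y) ++ image (drop (suc (suc j)) w)) s ≡⟨ at-++ˡ (f x ++ f y) _ s (subst (s <_) (sym length-pair) s<2k) ⟩
    at (f x ++ f y) s                                ∎
    where
    open ≡-Reasoning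
    length-pair : length (f x ++ f y) ≡ k + k
    length-pair = trans (length-++ (f x)) (cong₂ _+_ (length-f x) (length-f y))

𝟎 𝟏 𝟐 : Fin 3
𝟎 = zero
𝟏 = suc zero
𝟐 = suc (suc zero)

-- The 13-uniform morphism of the construction; h 𝟏 and h 𝟐 are obtained from h 𝟎 by
-- cyclically shifting the letters.
h : Fin 3 → Word
h zero             = 𝟎 ∷ 𝟏 ∷ 𝟐 ∷ 𝟏 ∷ 𝟎 ∷ 𝟐 ∷ 𝟏 ∷ 𝟐 ∷ 𝟎 ∷ 𝟏 ∷ 𝟐 ∷ 𝟏 ∷ 𝟎 ∷ []
h (suc zero)       = 𝟏 ∷ 𝟐 ∷ 𝟎 ∷ 𝟐 ∷ 𝟏 ∷ 𝟎 ∷ 𝟐 ∷ 𝟎 ∷ 𝟏 ∷ 𝟐 ∷ 𝟎 ∷ 𝟐 ∷ 𝟏 ∷ []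
h (suc (suc zero)) = 𝟐 ∷ 𝟎 ∷ 𝟏 ∷ 𝟎 ∷ 𝟐 ∷ 𝟏 ∷ 𝟎 ∷ 𝟏 ∷ 𝟐 ∷ 𝟎 ∷ 𝟏 ∷ 𝟎 ∷ 𝟐 ∷ []

length-h : ∀ a → length (h a) ≡ 13
length-h zero             = refl
length-h (suc zero)       = refl
length-h (suc (suc zero)) = refl

h-head : ∀ a → at (h a) 0 ≡ just a
h-head zero             = refl
h-head (suc zero)       = refl
h-head (suc (suc zero)) = refl

open UniformMorphism h 13 length-h renaming (image to H)
open Decide (Fin._≟_ {3})

at-H-block : ∀ w j → at (H w) (j * 13) ≡ at w j
at-H-block w j = begin
  at (H w) (j * 13)               ≡⟨ cong (at (H w)) (sym (+-identityʳ (j * 13))) ⟩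
  at (H w) (j * 13 + 0)           ≡⟨ at-image w j 0 (s≤s z≤n) ⟩
  (at w j >>= λ a → at (h a) 0)   ≡⟨ block-head (at w j) ⟩
  at w j                          ∎
  where
  open ≡-Reasoning
  block-head : ∀ m → (m >>= λ a → at (h a) 0) ≡ m
  block-head nothing  = refl
  block-head (just a) = h-head a

allWords : ℕ → (Word → Bool) → Bool
allWords zero    test = test []
allWords (suc n) test = all (λ x → allWords n (λ v → test (x ∷ v))) (allFin 3)

allWords-sound : ∀ n test → allWords n test ≡ true → ∀ v → length v ≡ n → T (test v)
allWords-sound zero    test ok []      refl = Equivalence.from T-≡ ok
allWords-sound (suc n) test ok (x ∷ v) refl = allWords-sound n (λ u → test (x ∷ u))
  (Equivalence.to T-≡ (all-sound (λ x → allWords n (λ v → test (x ∷ v))) (allFin 3) ok (∈-allFin x))) v refl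

preservesSquarefree : Word → Bool
preservesSquarefree v = not (squarefree? v) ∨ squarefree? (H v)

H-squarefree-5-check : allWords 5 preservesSquarefree ≡ true
H-squarefree-5-check = refl

H-squarefree-5 : ∀ v → length v ≡ 5 → SqFree v → SqFree (H v)
H-squarefree-5 v len sf = squarefree?-sound (H v)
  (T-∨-right {not (squarefree? v)} (allWords-sound 5 preservesSquarefree H-squarefree-5-check v len)
             (λ not-sf → T-not⇒¬T {squarefree? v} not-sf (squarefree?-complete v sf)))

-- Finite check: for distinct letters x ≠ y, no image h z occurs in h x ++ h y
-- at an offset 1, …, 12 (h is synchronizing).
noOccurrence : Fin 3 → Fin 3 → Fin 3 → ℕ → Bool
noOccurrence x y z s = not (agree 13 (h z) (drop (suc s) (h x ++ h y)))

separated : Fin 3 → Fin 3 → Bool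
separated x y = isYes (x Fin.≟ y) ∨ all (λ z → all (noOccurrence x y z) (upTo 12)) (allFin 3)

h-synchronizing-check : all (λ x → all (separated x) (allFin 3)) (allFin 3) ≡ true
h-synchronizing-check = refl

h-synchronizing : ∀ {x y} z s → x ≢ y → s < 12 →
                  ¬ (∀ t → t < 13 → at (h z) t ≡ at (h x ++ h y) (suc s + t))
h-synchronizing {x} {y} z s x≢y s<12 occurs = T-not⇒¬T {agree 13 (h z) (drop (suc s) (h x ++ h y))} no-occurrence
  (agree-complete 13 (h z) (drop (suc s) (h x ++ h y))
    (λ t t<13 → trans (occurs t t<13) (sym (at-drop (suc s) (h x ++ h y) t))))
  where
  separated-xy : T (separated x y)
  separated-xy = all-sound (separated x) (allFin 3)
    (Equivalence.to T-≡ (all-sound (λ x → all (separated x) (allFin 3)) (allFin 3) h-synchronizing-check (∈-allFin x)))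
    (∈-allFin y)
  no-occurrence : T (noOccurrence x y z s)
  no-occurrence = all-sound (noOccurrence x y z) (upTo 12)
    (Equivalence.to T-≡ (all-sound (λ z → all (noOccurrence x y z) (upTo 12)) (allFin 3)
      (Equivalence.to T-≡ (T-∨-right {isYes (x Fin.≟ y)} separated-xy (λ x≡y → x≢y (toWitness {a? = x Fin.≟ y} x≡y))))
      (∈-allFin z)))
    (∈-upTo⁺ s<12)

no-square-in-window : ∀ w → SqFree w → ∀ a {i l} → a + 5 ≤ length w → a * 13 ≤ i →
                      i + l + l ≤ a * 13 + 65 → ¬ SqAt (H w) i l
no-square-in-window w sf a {i} {l} a+5≤ a13≤i inside sq =
  H-squarefree-5 v length-v (sqFree-occurs {v = v} {w = w} {a = a} (factor-occurs w a 5 a+5≤) sf) (i ∸ a * 13) l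
    (sqAt-lower {v = H v} {w = H w} {a = a * 13} occurs-H a13≤i inside′ sq)
  where
  v = take 5 (drop a w)
  length-v : length v ≡ 5
  length-v = length-factor w a 5 a+5≤
  image-v : H v ≡ take 65 (drop (a * 13) (H w))
  image-v = trans (image-take 5 (drop a w)) (cong (take 65) (image-drop a w))
  fits : a * 13 + 65 ≤ length (H w)
  fits = subst₂ _≤_ (*-distribʳ-+ 13 a 5) (sym (length-image w)) (*-monoˡ-≤ 13 a+5≤)
  occurs-H : Occurs (H v) (H w) (a * 13)
  occurs-H = subst (λ u → Occurs u (H w) (a * 13)) (sym image-v) (factor-occurs (H w) (a * 13) 65 fits)
  inside′ : i + l + l ≤ a * 13 + length (H v)
  inside′ = subst (λ n → i + l + l ≤ a * 13 + n) (sym (trans (length-image v) (cong (_* 13) length-v))) inside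

-- Squares of half-length at most 24 in H w fit in the image of 5 consecutive letters.
short-squares : ∀ w → 5 ≤ length w → SqFree w → ∀ i l → l ≤ 24 → ¬ SqAt (H w) i l
short-squares w 5≤n sf i l l≤24 sq with i / 13 + 5 ≤? length w
... | yes a+5≤ = no-square-in-window w sf (i / 13) a+5≤ (m/n*n≤m i 13) inside sq
  where
  inside : i + l + l ≤ i / 13 * 13 + 65
  inside = begin
    i + l + l                      ≡⟨ cong (λ m → m + l + l) (m≡m%n+[m/n]*n i 13) ⟩
    i % 13 + i / 13 * 13 + l + l   ≤⟨ +-mono-≤ (+-mono-≤ (+-monoˡ-≤ (i / 13 * 13) (≤-pred (m%n<n i 13))) l≤24) l≤24 ⟩
    12 + i / 13 * 13 + 24 + 24     ≡⟨ solve 1 (λ x → ((con 12 :+ x) :+ con 24) :+ con 24 := x :+ con 60) refl (i / 13 * 13) ⟩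
    i / 13 * 13 + 60               ≤⟨ +-monoʳ-≤ (i / 13 * 13) (m≤m+n 60 5) ⟩
    i / 13 * 13 + 65               ∎
    where open ≤-Reasoning
... | no a+5≰ = no-square-in-window w sf (length w ∸ 5) (≤-reflexive (m∸n+n≡m 5≤n)) start≤ inside sq
  where
  start≤ : (length w ∸ 5) * 13 ≤ i
  start≤ = ≤-trans (*-monoˡ-≤ 13 (≤-trans (∸-monoˡ-≤ 5 (<⇒≤ (≰⇒> a+5≰))) (≤-reflexive (m+n∸n≡m (i / 13) 5))))
                   (m/n*n≤m i 13)
  inside : i + l + l ≤ (length w ∸ 5) * 13 + 65
  inside = begin
    i + l + l                    ≤⟨ proj₁ (proj₂ sq) ⟩
    length (H w)                 ≡⟨ length-image w ⟩
    length w * 13                ≡⟨ cong (_* 13) (sym (m∸n+n≡m 5≤n)) ⟩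
    (length w ∸ 5 + 5) * 13      ≡⟨ *-distribʳ-+ 13 (length w ∸ 5) 5 ⟩
    (length w ∸ 5) * 13 + 65     ∎
    where open ≤-Reasoning

block-aligned : ∀ w → SqFree w → ∀ c p → c < length w → p + 13 ≤ length w * 13 →
                (∀ t → t < 13 → at (H w) (c * 13 + t) ≡ at (H w) (p + t)) → Σ ℕ λ k → p ≡ k * 13
block-aligned w sf c p c<n p+13≤ same with p % 13 | m≡m%n+[m/n]*n p 13 | m%n<n p 13
... | zero  | p≡ | _    = p / 13 , p≡
... | suc r | p≡ | r<13 = ⊥-elim (h-synchronizing (proj₁ z-at) r x≢y (≤-pred r<13) occurrence)
  where
  k = p / 13
  k+1<n : suc k < length w
  k+1<n = *-cancelʳ-< 13 (suc k) (length w) (begin-strict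
    13 + k * 13           <⟨ +-monoˡ-< (k * 13) (s≤s (m≤n+m 13 r)) ⟩
    suc r + 13 + k * 13   ≡⟨ solve 2 (λ a b → (a :+ con 13) :+ b := (a :+ b) :+ con 13) refl (suc r) (k * 13) ⟩
    suc r + k * 13 + 13   ≡⟨ cong (_+ 13) (sym p≡) ⟩
    p + 13                ≤⟨ p+13≤ ⟩
    length w * 13         ∎)
    where open ≤-Reasoning
  x-at = at-just w k (<-trans (n<1+n k) k+1<n)
  y-at = at-just w (suc k) k+1<n
  z-at = at-just w c c<n
  x≢y : proj₁ x-at ≢ proj₁ y-at
  x≢y = adjacent-distinct w sf k (proj₂ x-at) (proj₂ y-at)
  occurrence : ∀ t → t < 13 → at (h (proj₁ z-at)) t ≡ at (h (proj₁ x-at) ++ h (proj₁ y-at)) (suc r + t)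
  occurrence t t<13 = begin
    at (h (proj₁ z-at)) t            ≡⟨ sym (at-image-letter w c t (proj₂ z-at) t<13) ⟩
    at (H w) (c * 13 + t)            ≡⟨ same t t<13 ⟩
    at (H w) (p + t)                 ≡⟨ cong (λ q → at (H w) (q + t)) p≡ ⟩
    at (H w) (suc r + k * 13 + t)    ≡⟨ cong (at (H w)) (solve 3 (λ a b c → (a :+ b) :+ c := b :+ (a :+ c)) refl (suc r) (k * 13) t) ⟩
    at (H w) (k * 13 + (suc r + t))  ≡⟨ at-image-pair w k (suc r + t) (proj₂ x-at) (proj₂ y-at)
                                          (subst (_≤ 26) (+-suc (suc r) t) (+-mono-≤ (<⇒≤ r<13) t<13)) ⟩
    at (h (proj₁ x-at) ++ h (proj₁ y-at)) (suc r + t) ∎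
    where open ≡-Reasoning

roundUp13 : ∀ i → Σ ℕ λ c → Σ ℕ λ d → d ≤ 12 × c * 13 ≡ i + d
roundUp13 zero = 0 , 0 , z≤n , refl
roundUp13 (suc i) with roundUp13 i
... | c , suc d , d<12 , c≡ = c , d , ≤-trans (n≤1+n d) d<12 , trans c≡ (+-suc i d)
... | c , zero  , _    , c≡ = suc c , 12 , ≤-refl ,
  trans (cong (13 +_) (trans c≡ (+-identityʳ i))) (solve 1 (λ a → con 13 :+ a := (con 1 :+ a) :+ con 12) refl i)

shifted-repeat : ∀ {A : Set} (v : List A) {i l m d} → SqAt v i l → m ≡ i + d →
                 ∀ x → d + x < l → at v (m + x) ≡ at v (m + l + x)
shifted-repeat v {i} {l} {m} {d} (_ , _ , repeat) refl x d+x<l = begin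
  at v (i + d + x)       ≡⟨ cong (at v) (+-assoc i d x) ⟩
  at v (i + (d + x))     ≡⟨ repeat (d + x) d+x<l ⟩
  at v (i + l + (d + x)) ≡⟨ cong (at v) (solve 4 (λ i l d x → (i :+ l) :+ (d :+ x) := ((i :+ d) :+ l) :+ x) refl i l d x) ⟩
  at v (i + d + l + x)   ∎
  where open ≡-Reasoning

block-square : ∀ w c K → 1 ≤ K → c + K + K ≤ length w →
               (∀ t → t < K → at (H w) ((c + t) * 13) ≡ at (H w) ((c + K + t) * 13)) → SqAt w c K
block-square w c K K≥1 fits same = K≥1 , fits ,
  λ t t<K → trans (sym (at-H-block w (c + t))) (trans (same t t<K) (at-H-block w (c + K + t)))

-- By synchronization, the half-length of a long square of H w is a multiple of 13.
long-square-aligned : ∀ w → SqFree w → ∀ {i l c d} → SqAt (H w) i l → 25 ≤ l → d ≤ 12 →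
                      c * 13 ≡ i + d → Σ ℕ λ K → l ≡ K * 13
long-square-aligned w sf {i} {l} {c} {d} sq@(_ , fits , _) l≥25 d≤12 c≡ = k ∸ c , l≡
  where
  block-fits : c * 13 + l + 13 ≤ length w * 13
  c<n : c < length w
  aligned : Σ ℕ λ k → c * 13 + l ≡ k * 13
  aligned = block-aligned w sf c (c * 13 + l) c<n block-fits
    (λ t t<13 → shifted-repeat (H w) sq c≡ t (≤-trans (s≤s (+-mono-≤ d≤12 (≤-pred t<13))) l≥25))
  k = proj₁ aligned
  l≡ : l ≡ (k ∸ c) * 13
  l≡ = begin
    l                     ≡⟨ sym (m+n∸m≡n (c * 13) l) ⟩
    c * 13 + l ∸ c * 13   ≡⟨ cong (_∸ c * 13) (proj₂ aligned) ⟩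
    k * 13 ∸ c * 13       ≡⟨ sym (*-distribʳ-∸ 13 k c) ⟩
    (k ∸ c) * 13          ∎
    where open ≡-Reasoning
  fits′ : i + l + l ≤ length w * 13
  fits′ = subst (i + l + l ≤_) (length-image w) fits
  block-fits = begin
    c * 13 + l + 13    ≡⟨ cong (λ m → m + l + 13) c≡ ⟩
    i + d + l + 13     ≡⟨ solve 4 (λ i d l x → ((i :+ d) :+ l) :+ x := (i :+ l) :+ (d :+ x)) refl i d l 13 ⟩
    i + l + (d + 13)   ≤⟨ +-monoʳ-≤ (i + l) (≤-trans (+-monoˡ-≤ 13 d≤12) l≥25) ⟩
    i + l + l          ≤⟨ fits′ ⟩
    length w * 13      ∎
    where open ≤-Reasoning
  c<n = *-cancelʳ-< 13 c (length w) (begin-strict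
    c * 13             ≡⟨ c≡ ⟩
    i + d              <⟨ +-monoʳ-< i (≤-trans (s≤s d≤12) (≤-trans (≤-trans (m≤m+n 13 12) l≥25) (m≤m+n l l))) ⟩
    i + (l + l)        ≡⟨ sym (+-assoc i l l) ⟩
    i + l + l          ≤⟨ fits′ ⟩
    length w * 13      ∎)
    where open ≤-Reasoning

-- Squares of half-length at least 25 in H w descend to squares of w.
long-squares : ∀ w → SqFree w → ∀ i l → 25 ≤ l → ¬ SqAt (H w) i l
long-squares w sf i l l≥25 sq@(_ , fits , _) with roundUp13 i
... | c , d , d≤12 , c≡ with long-square-aligned w sf {c = c} sq l≥25 d≤12 c≡
... | K , refl = sf c K (block-square w c K K≥1 range sparse)
  where
  K≥1 : 1 ≤ K
  K≥1 = *-cancelʳ-≤ 1 K 13 (≤-trans (m≤m+n 13 12) l≥25)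
  range : c + K + K ≤ length w
  range = ≤-pred (*-cancelʳ-< 13 (c + K + K) (suc (length w)) (begin-strict
    (c + K + K) * 13                ≡⟨ solve 2 (λ c K → ((c :+ K) :+ K) :* con 13 := ((c :* con 13) :+ (K :* con 13)) :+ (K :* con 13)) refl c K ⟩
    c * 13 + K * 13 + K * 13        ≡⟨ cong (λ m → m + K * 13 + K * 13) c≡ ⟩
    i + d + K * 13 + K * 13         ≡⟨ solve 3 (λ i d l → ((i :+ d) :+ l) :+ l := ((i :+ l) :+ l) :+ d) refl i d (K * 13) ⟩
    i + K * 13 + K * 13 + d         <⟨ +-mono-≤-< (subst (i + K * 13 + K * 13 ≤_) (length-image w) fits) (s≤s d≤12) ⟩
    length w * 13 + 13              ≡⟨ +-comm (length w * 13) 13 ⟩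
    suc (length w) * 13             ∎))
    where open ≤-Reasoning
  sparse : ∀ t → t < K → at (H w) ((c + t) * 13) ≡ at (H w) ((c + K + t) * 13)
  sparse t t<K = begin
    at (H w) ((c + t) * 13)               ≡⟨ cong (at (H w)) (*-distribʳ-+ 13 c t) ⟩
    at (H w) (c * 13 + t * 13)            ≡⟨ shifted-repeat (H w) sq c≡ (t * 13) (<-≤-trans (+-monoˡ-< (t * 13) (s≤s d≤12)) (*-monoˡ-≤ 13 t<K)) ⟩
    at (H w) (c * 13 + K * 13 + t * 13)   ≡⟨ cong (at (H w)) (solve 3 (λ c K t → ((c :* con 13) :+ (K :* con 13)) :+ (t :* con 13) := ((c :+ K) :+ t) :* con 13) refl c K t) ⟩
    at (H w) ((c + K + t) * 13)           ∎
    where open ≡-Reasoning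

H-squarefree : ∀ w → 5 ≤ length w → SqFree w → SqFree (H w)
H-squarefree w 5≤n sf i l with l ≤? 24
... | yes l≤24 = short-squares w 5≤n sf i l l≤24
... | no  l≰24 = long-squares w sf i l (≰⇒> l≰24)

scaled-period : ∀ w k → IsNontrivialPeriod w k → IsNontrivialPeriod (H w) (k * 13)
scaled-period w k ((k≥1 , _ , per) , k<n) = (≤-trans k≥1 (m≤m*n k 13) , <⇒≤ k13< , per′) , k13<
  where
  k13< : k * 13 < length (H w)
  k13< = subst (k * 13 <_) (sym (length-image w)) (*-monoˡ-< 13 k<n)
  per′ : ∀ i → i + k * 13 < length (H w) → at (H w) i ≡ at (H w) (i + k * 13)
  per′ i i+k13< = begin
    at (H w) i                                ≡⟨ cong (at (H w)) i≡ ⟩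
    at (H w) (i / 13 * 13 + i % 13)           ≡⟨ at-image w (i / 13) (i % 13) (m%n<n i 13) ⟩
    (at w (i / 13) >>= λ a → at (h a) (i % 13)) ≡⟨ cong (_>>= λ a → at (h a) (i % 13)) (per (i / 13) in-range) ⟩
    (at w (i / 13 + k) >>= λ a → at (h a) (i % 13)) ≡⟨ sym (at-image w (i / 13 + k) (i % 13) (m%n<n i 13)) ⟩
    at (H w) ((i / 13 + k) * 13 + i % 13)     ≡⟨ cong (at (H w)) shifted ⟩
    at (H w) (i + k * 13)                     ∎
    where
    open ≡-Reasoning
    i≡ : i ≡ i / 13 * 13 + i % 13
    i≡ = trans (m≡m%n+[m/n]*n i 13) (+-comm (i % 13) _)
    shifted : (i / 13 + k) * 13 + i % 13 ≡ i + k * 13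
    shifted = trans (solve 3 (λ a k s → (a :+ k) :* con 13 :+ s := (a :* con 13 :+ s) :+ k :* con 13) refl (i / 13) k (i % 13))
                    (cong (_+ k * 13) (sym i≡))
    in-range : i / 13 + k < length w
    in-range = *-cancelʳ-< 13 (i / 13 + k) (length w)
      (≤-<-trans (≤-trans (m≤m+n _ (i % 13)) (≤-reflexive shifted)) (subst (i + k * 13 <_) (length-image w) i+k13<))

-- A nontrivial period q of H w leaving room for a whole block (q + 13 ≤ |H w|) is 13k for a
-- nontrivial period k of w: by synchronization the first block reappears at a block start.
aligned-period : ∀ w → SqFree w → 0 < length w → ∀ q → IsNontrivialPeriod (H w) q →
                 q + 13 ≤ length (H w) → Σ ℕ λ k → IsNontrivialPeriod w k × q ≡ k * 13
aligned-period w sf 0<n q ((q≥1 , _ , per) , q<) q+13≤ = k , ((k≥1 , <⇒≤ k<n , per-w) , k<n) , q≡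
  where
  aligned : Σ ℕ λ k → q ≡ k * 13
  aligned = block-aligned w sf 0 q 0<n (subst (q + 13 ≤_) (length-image w) q+13≤)
    (λ t t<13 → trans (per t (<-≤-trans (+-monoˡ-< q t<13) (subst (_≤ length (H w)) (+-comm q 13) q+13≤)))
                      (cong (at (H w)) (+-comm t q)))
  k = proj₁ aligned
  q≡ = proj₂ aligned
  k≥1 : 1 ≤ k
  k≥1 = n≢0⇒n>0 λ k≡0 → <⇒≢ q≥1 (sym (trans q≡ (cong (_* 13) k≡0)))
  k<n : k < length w
  k<n = *-cancelʳ-< 13 k (length w) (subst₂ _<_ q≡ (length-image w) q<)
  per-w : ∀ i → i + k < length w → at w i ≡ at w (i + k)
  per-w i i+k< = begin
    at w i                  ≡⟨ sym (at-H-block w i) ⟩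
    at (H w) (i * 13)       ≡⟨ per (i * 13) (subst₂ _<_ (sym shifted) (sym (length-image w)) (*-monoˡ-< 13 i+k<)) ⟩
    at (H w) (i * 13 + q)   ≡⟨ cong (at (H w)) shifted ⟩
    at (H w) ((i + k) * 13) ≡⟨ at-H-block w (i + k) ⟩
    at w (i + k)            ∎
    where
    open ≡-Reasoning
    shifted : i * 13 + q ≡ (i + k) * 13
    shifted = trans (cong (i * 13 +_) q≡) (sym (*-distribʳ-+ 13 i k))

multiple≢offset : ∀ k m e → 0 < e → e < 13 → k * 13 ≢ m * 13 + e
multiple≢offset k m e 0<e e<13 k13≡ = <⇒≢ 0<e (begin
  0                    ≡⟨ sym (m*n%n≡0 k 13) ⟩
  k * 13 % 13          ≡⟨ cong (_% 13) (trans k13≡ (+-comm (m * 13) e)) ⟩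
  (e + m * 13) % 13    ≡⟨ [m+kn]%n≡m%n e m 13 ⟩
  e % 13               ≡⟨ m<n⇒m%n≡m e<13 ⟩
  e                    ∎)
  where open ≡-Reasoning

module Border (a : Fin 3) (w : Word) (m : ℕ) (length-w : length w ≡ suc m)
              (starts : at w 0 ≡ just a) (ends : at w m ≡ just a) where

  -- Start of the last block.
  M : ℕ
  M = m * 13

  length-Hw : length (H w) ≡ M + 13
  length-Hw = trans (length-image w) (trans (cong (_* 13) length-w) (+-comm 13 M))

  first-block : ∀ s → s < 13 → at (H w) s ≡ at (h a) s
  first-block s s<13 = at-image-letter w 0 s starts s<13

  last-block : ∀ s → s < 13 → at (H w) (M + s) ≡ at (h a) s
  last-block s s<13 = at-image-letter w m s ends s<13

  -- A nontrivial period e of h a gives the nontrivial period M + e of H w: H w begins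
  -- and ends with h a.
  border-period : ∀ e → IsNontrivialPeriod (h a) e → IsNontrivialPeriod (H w) (M + e)
  border-period e ((e≥1 , _ , per) , e<) = (≤-trans e≥1 (m≤n+m e M) , <⇒≤ q< , per′) , q<
    where
    e<13 : e < 13
    e<13 = subst (e <_) (length-h a) e<
    q< : M + e < length (H w)
    q< = subst (M + e <_) (sym length-Hw) (+-monoʳ-< M e<13)
    per′ : ∀ i → i + (M + e) < length (H w) → at (H w) i ≡ at (H w) (i + (M + e))
    per′ i i+q< = begin
      at (H w) i              ≡⟨ first-block i (≤-<-trans (m≤m+n i e) i+e<13) ⟩
      at (h a) i              ≡⟨ per i (subst (i + e <_) (sym (length-h a)) i+e<13) ⟩
      at (h a) (i + e)        ≡⟨ sym (last-block (i + e) i+e<13) ⟩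
      at (H w) (M + (i + e))  ≡⟨ cong (at (H w)) (solve 3 (λ M i e → M :+ (i :+ e) := i :+ (M :+ e)) refl M i e) ⟩
      at (H w) (i + (M + e))  ∎
      where
      open ≡-Reasoning
      i+e<13 : i + e < 13
      i+e<13 = +-cancelˡ-< M (i + e) 13
        (subst₂ _<_ (solve 3 (λ M e i → i :+ (M :+ e) := M :+ (i :+ e)) refl M e i) length-Hw i+q<)

  period-cases : SqFree w → ∀ q → IsNontrivialPeriod (H w) q →
    (Σ ℕ λ k → IsNontrivialPeriod w k × q ≡ k * 13) ⊎ (Σ ℕ λ e → IsNontrivialPeriod (h a) e × q ≡ M + e)
  period-cases sf q period@((q≥1 , _ , per) , q<) with q + 13 ≤? length (H w)
  ... | yes q+13≤ = inj₁ (aligned-period w sf (subst (0 <_) (sym length-w) (s≤s z≤n)) q period q+13≤)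
  ... | no  q+13≰ = inj₂ (e , ((e≥1 , <⇒≤ e<ha , per-e) , e<ha) , q≡)
    where
    M<q : M < q
    M<q = +-cancelˡ-< 13 M q (subst₂ _<_ (trans length-Hw (+-comm M 13)) (+-comm q 13) (≰⇒> q+13≰))
    e = q ∸ M
    q≡ : q ≡ M + e
    q≡ = sym (m+[n∸m]≡n (<⇒≤ M<q))
    e≥1 : 1 ≤ e
    e≥1 = m+n≤o⇒m≤o∸n 1 M<q
    e<13 : e < 13
    e<13 = +-cancelˡ-< M e 13 (subst₂ _<_ q≡ length-Hw q<)
    e<ha : e < length (h a)
    e<ha = subst (e <_) (sym (length-h a)) e<13
    per-e : ∀ i → i + e < length (h a) → at (h a) i ≡ at (h a) (i + e)
    per-e i i+e< = begin
      at (h a) i              ≡⟨ sym (first-block i (≤-<-trans (m≤m+n i e) i+e<13)) ⟩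
      at (H w) i              ≡⟨ per i (subst (_< length (H w)) (sym shifted) (subst (M + (i + e) <_) (sym length-Hw) (+-monoʳ-< M i+e<13))) ⟩
      at (H w) (i + q)        ≡⟨ cong (at (H w)) shifted ⟩
      at (H w) (M + (i + e))  ≡⟨ last-block (i + e) i+e<13 ⟩
      at (h a) (i + e)        ∎
      where
      open ≡-Reasoning
      i+e<13 : i + e < 13
      i+e<13 = subst (i + e <_) (length-h a) i+e<
      shifted : i + q ≡ M + (i + e)
      shifted = trans (cong (i +_) q≡) (solve 3 (λ i M e → i :+ (M :+ e) := M :+ (i :+ e)) refl i M e)

  image-periods : SqFree w → ∀ {p r} → HasExactlyNontrivialPeriods w p →
                  HasExactlyNontrivialPeriods (h a) r → HasExactlyNontrivialPeriods (H w) (p + r)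
  image-periods sf {p} {r} (ks , ks-unique , ks-exact , ks-length) (es , es-unique , es-exact , es-length) =
    qs , unique , (λ q → listed-period q , period-listed q) , length-qs
    where
    qs = map (_* 13) ks ++ map (M +_) es
    listed-period : ∀ q → q ∈ qs → IsNontrivialPeriod (H w) q
    listed-period q q∈ with ∈-++⁻ (map (_* 13) ks) q∈
    ... | inj₁ q∈ks with ∈-map⁻ (_* 13) q∈ks
    ...   | k , k∈ , refl = scaled-period w k (proj₁ (ks-exact k) k∈)
    listed-period q q∈ | inj₂ q∈es with ∈-map⁻ (M +_) q∈es
    ...   | e , e∈ , refl = border-period e (proj₁ (es-exact e) e∈)
    period-listed : ∀ q → IsNontrivialPeriod (H w) q → q ∈ qs
    period-listed q period with period-cases sf q period
    ... | inj₁ (k , k-period , refl) = ∈-++⁺ˡ (∈-map⁺ (_* 13) (proj₂ (ks-exact k) k-period))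
    ... | inj₂ (e , e-period , refl) = ∈-++⁺ʳ (map (_* 13) ks) (∈-map⁺ (M +_) (proj₂ (es-exact e) e-period))
    disjoint : ∀ {v} → ¬ (v ∈ map (_* 13) ks × v ∈ map (M +_) es)
    disjoint (v∈ks , v∈es) with ∈-map⁻ (_* 13) v∈ks | ∈-map⁻ (M +_) v∈es
    ... | k , _ , refl | e , e∈ , k13≡ =
      let ((e≥1 , _) , e<) = proj₁ (es-exact e) e∈
      in multiple≢offset k m e e≥1 (subst (e <_) (length-h a) e<) k13≡
    unique : Unique qs
    unique = Unique.++⁺ (Unique.map⁺ (λ {x} {y} → *-cancelʳ-≡ x y 13) ks-unique)
                        (Unique.map⁺ (+-cancelˡ-≡ M _ _) es-unique) disjoint
    length-qs : length qs ≡ p + r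
    length-qs = trans (length-++ (map (_* 13) ks))
                      (cong₂ _+_ (trans (length-map (_* 13) ks) ks-length) (trans (length-map (M +_) es) es-length))

record Witness (p : ℕ) (w : Word) : Set where
  field
    last       : ℕ
    length≡    : length w ≡ suc last
    long       : 4 ≤ last
    starts     : at w 0 ≡ just 𝟎
    ends       : at w last ≡ just 𝟎
    squarefree : SqFree w
    periods    : HasExactlyNontrivialPeriods w p
    short      : 12 * length w ≤ 17 * 4 ^ (p ∸ 1) + 4

-- h 𝟎 has exactly two nontrivial periods (namely 8 and 12).
h𝟎-periods : HasExactlyNontrivialPeriods (h 𝟎) 2
h𝟎-periods = periodList-exact (h 𝟎)

-- Multiplying the length by 13 stays within the bound when p grows by 2, as 13 · 17 + 51 = 16 · 17.
bound-step : ∀ n L → 12 * L ≤ 17 * 4 ^ n + 4 → 12 * (L * 13) ≤ 17 * 4 ^ (2 + n) + 4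
bound-step n L bound = begin
  12 * (L * 13)               ≡⟨ solve 1 (λ L → con 12 :* (L :* con 13) := con 13 :* (con 12 :* L)) refl L ⟩
  13 * (12 * L)               ≤⟨ *-monoʳ-≤ 13 bound ⟩
  13 * (17 * X + 4)           ≡⟨ solve 1 (λ X → con 13 :* (con 17 :* X :+ con 4) := (con 221 :* X :+ con 48) :+ con 4) refl X ⟩
  221 * X + 48 + 4            ≤⟨ +-monoˡ-≤ 4 (+-monoʳ-≤ (221 * X) (*-monoʳ-≤ 48 (m^n>0 4 n))) ⟩
  221 * X + 48 * X + 4        ≤⟨ +-monoˡ-≤ 4 (+-monoʳ-≤ (221 * X) (*-monoˡ-≤ X (m≤m+n 48 3))) ⟩
  221 * X + 51 * X + 4        ≡⟨ solve 1 (λ X → (con 221 :* X :+ con 51 :* X) :+ con 4 := con 17 :* (con 4 :* (con 4 :* X)) :+ con 4) refl X ⟩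
  17 * (4 * (4 * X)) + 4      ∎
  where
  open ≤-Reasoning
  X = 4 ^ n

step : ∀ n w → Witness (suc n) w → Witness (3 + n) (H w)
step n w wit = record
  { last       = 12 + M
  ; length≡    = trans length-Hw (+-comm M 13)
  ; long       = ≤-trans (m≤m+n 4 8) (m≤m+n 12 M)
  ; starts     = first-block 0 (s≤s z≤n)
  ; ends       = trans (cong (at (H w)) (+-comm 12 M)) (last-block 12 ≤-refl)
  ; squarefree = H-squarefree w (subst (5 ≤_) (sym length≡) (s≤s long)) squarefree
  ; periods    = subst (HasExactlyNontrivialPeriods (H w)) (+-comm (suc n) 2) (image-periods squarefree periods h𝟎-periods)
  ; short      = subst (λ L → 12 * L ≤ 17 * 4 ^ (2 + n) + 4) (sym (length-image w)) (bound-step n (length w) short)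
  }
  where
  open Witness wit
  open Border 𝟎 w last length≡ starts ends

-- The seeds for p = 3 and p = 4, of lengths 23 and 91 (both meeting the bound with equality).
w₃ : Word
w₃ = 𝟎 ∷ 𝟏 ∷ 𝟎 ∷ 𝟐 ∷ 𝟏 ∷ 𝟐 ∷ 𝟎 ∷ 𝟏 ∷ 𝟎 ∷ 𝟐 ∷ 𝟏 ∷ 𝟎 ∷ 𝟏 ∷ 𝟐 ∷ 𝟎 ∷ 𝟏 ∷ 𝟎 ∷ 𝟐 ∷ 𝟏 ∷ 𝟐 ∷ 𝟎 ∷ 𝟏 ∷ 𝟎 ∷ []

w₄ : Word
w₄ = 𝟎 ∷ 𝟏 ∷ 𝟎 ∷ 𝟐 ∷ 𝟏 ∷ 𝟐 ∷ 𝟎 ∷ 𝟏 ∷ 𝟎 ∷ 𝟐 ∷ 𝟎 ∷ 𝟏 ∷ 𝟐 ∷ 𝟏 ∷ 𝟎 ∷ 𝟐 ∷ 𝟎 ∷ 𝟏 ∷ 𝟎 ∷ 𝟐 ∷ 𝟏 ∷ 𝟐 ∷ 𝟎 ∷ 𝟏 ∷ 𝟎 ∷ 𝟐 ∷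
     𝟎 ∷ 𝟏 ∷ 𝟐 ∷ 𝟏 ∷ 𝟎 ∷ 𝟏 ∷ 𝟐 ∷ 𝟎 ∷ 𝟏 ∷ 𝟎 ∷ 𝟐 ∷ 𝟏 ∷ 𝟐 ∷ 𝟎 ∷ 𝟏 ∷ 𝟐 ∷ 𝟏 ∷ 𝟎 ∷ 𝟏 ∷ 𝟐 ∷ 𝟎 ∷ 𝟏 ∷ 𝟎 ∷ 𝟐 ∷
     𝟎 ∷ 𝟏 ∷ 𝟐 ∷ 𝟏 ∷ 𝟎 ∷ 𝟏 ∷ 𝟐 ∷ 𝟎 ∷ 𝟐 ∷ 𝟏 ∷ 𝟎 ∷ 𝟏 ∷ 𝟐 ∷ 𝟏 ∷ 𝟎 ∷ 𝟐 ∷ 𝟎 ∷ 𝟏 ∷ 𝟎 ∷ 𝟐 ∷ 𝟏 ∷ 𝟐 ∷ 𝟎 ∷ 𝟏 ∷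
     𝟎 ∷ 𝟐 ∷ 𝟎 ∷ 𝟏 ∷ 𝟐 ∷ 𝟏 ∷ 𝟎 ∷ 𝟐 ∷ 𝟎 ∷ 𝟏 ∷ 𝟎 ∷ 𝟐 ∷ 𝟏 ∷ 𝟐 ∷ 𝟎 ∷ 𝟏 ∷ 𝟎 ∷ []

seed₃ : Witness 3 w₃
seed₃ = record
  { last = 22 ; length≡ = refl ; long = ≤ᵇ⇒≤ 4 22 _ ; starts = refl ; ends = refl
  ; squarefree = squarefree?-sound w₃ (Equivalence.from T-≡ refl) ; periods = periodList-exact w₃ ; short = ≤-refl }

seed₄ : Witness 4 w₄
seed₄ = record
  { last = 90 ; length≡ = refl ; long = ≤ᵇ⇒≤ 4 90 _ ; starts = refl ; ends = refl
  ; squarefree = squarefree?-sound w₄ (Equivalence.from T-≡ refl) ; periods = periodList-exact w₄ ; short = ≤-refl }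

witness : ∀ p → 3 ≤ p → Σ Word (Witness p)
witness 1 (s≤s ())
witness 2 (s≤s (s≤s ()))
witness 3 _ = w₃ , seed₃
witness 4 _ = w₄ , seed₄
witness (suc (suc (suc (suc (suc p))))) _ with witness (3 + p) (s≤s (s≤s (s≤s z≤n)))
... | w , wit = H w , step (2 + p) w wit

theorem22 : (p : ℕ) → 3 ≤ p →
    Σ Word λ w → Squarefree w × HasExactlyNontrivialPeriods w p ×
      (12 * length w ≤ 17 * 4 ^ (p ∸ 1) + 4)
theorem22 p 3≤p with witness p 3≤p
... | w , wit = w , sqFree⇒squarefree w squarefree , periods , short
  where open Witness wit
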